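{- Let $1\leq i, j\leq m$. For any $(x,y)\in \mathbb{X}_j^*$ and $(x',y)\in \mathbb{X}_{i}^*$, if $[x']_{i}=[x]_{i}$, then $x'=\pi_{i}(x)$.
   Context: Fix $m\geq 3$. Let $\gamma_0^*:=4m$ and $\gamma_i^*:=4(m-i)\gamma_{i-1}^*$ for $0<i<m$. For $0\leq j\leq i\leq m-1$ let $\beta_{j}^{i}:=\gamma_i^*/\gamma_j^*$ (a positive integer). For $x\in\{0,\ldots,\gamma_{m-1}^*-1\}$ and $1\leq i\leq m$ let $[x]_i:=\lfloor x/\beta_{m-i}^{m-1}\rfloor$ and let $\pi_i(x):=[x]_i\,\beta_{m-i}^{m-1}+\frac{1}{2}\sum_{1<\ell\leq i}\beta_{m-\ell}^{m-1}$ (in the paper this quantity is written with a special double-parenthesis notation; $(\pi_i(x),y)$ is called the projection of $(x,y)$ in the $i$-th abstraction). Let $\mathbb{X}_1^*:=\{0,\ldots,\gamma_{m-1}^*-1\}\times\{0,1,2\}$ and, for $1<i\leq m$, $\mathbb{X}_i^*:=\{(x,y)\in\mathbb{X}_1^*\mid x=\pi_i(x)\}$ (the vertex set of the $i$-th abstraction). -}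

module Defs where

open import Data.Nat using (ℕ; zero; suc; _+_; _*_; _∸_; _<_)
open import Data.Nat.DivMod using (_/_)
open import Data.Fin using (Fin)
open import Data.Product using (_×_)
open import Relation.Binary.PropositionalEquality using (_≡_)

-- Natural-number division, guarded against a zero divisor (never used with
-- a zero divisor in the situations of the paper, where all γ*_j > 0).
div : ℕ → ℕ → ℕ
div n zero    = 0
div n (suc d) = n / suc d

γ* : ℕ → ℕ → ℕ
γ* m zero    = 4 * m
γ* m (suc i) = 4 * (m ∸ suc i) * γ* m i

-- β^i_j = γ*_i / γ*_j   (written  β m j i)
β : ℕ → ℕ → ℕ → ℕ
β m j i = div (γ* m i) (γ* m j)

B : ℕ → ℕ → ℕ
B m ℓ = β m (m ∸ ℓ) (m ∸ 1)

bracket : ℕ → ℕ → ℕ → ℕ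
bracket m i x = div x (B m i)

offsetSum : ℕ → ℕ → ℕ
offsetSum m zero          = 0
offsetSum m (suc zero)    = 0
offsetSum m (suc (suc k)) = offsetSum m (suc k) + B m (suc (suc k))

-- π_i(x) = [x]_i β^{m-1}_{m-i} + (1/2) Σ_{1<ℓ≤i} β^{m-1}_{m-ℓ}
-- (the sum is even for m ≥ 3, so ℕ-division by 2 is exact)
π : ℕ → ℕ → ℕ → ℕ
π m i x = bracket m i x * B m i + offsetSum m i / 2

InX : ℕ → ℕ → ℕ → Fin 3 → Set
InX m i x y = (x < γ* m (m ∸ 1)) × (1 < i → x ≡ π m i x)

-- For i = 1 the bracket is the identity (B m 1 = 1); for i > 1, x' is a fixed point
-- of π_i, which depends on x' only through [x']_i.

module Submission where

open import Defs
open import Data.Nat using (ℕ; suc; _*_; _+_; _∸_; _/_; _≤_; _<_; NonZero; >-nonZero; s≤s; z≤n)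
open import Data.Nat.Properties using (m*n≢0; m<n⇒0<n∸m; <-trans; n<1+n; ≤-trans; *-identityʳ; +-identityʳ)
open import Data.Nat.DivMod using (n/1≡n; n/n≡1)
open import Data.Fin using (Fin)
open import Data.Product using (proj₂)
open import Relation.Binary.PropositionalEquality using (_≡_; sym; trans; cong; module ≡-Reasoning)

γ*-nonZero : ∀ m k → k < m → NonZero (γ* m k)
γ*-nonZero m 0       0<m = m*n≢0 4 m {{_}} {{>-nonZero 0<m}}
γ*-nonZero m (suc k) k<m =
  m*n≢0 (4 * (m ∸ suc k)) (γ* m k)
    {{m*n≢0 4 (m ∸ suc k) {{_}} {{>-nonZero (m<n⇒0<n∸m k<m)}}}}
    {{γ*-nonZero m k (<-trans (n<1+n k) k<m)}}

div-self : ∀ n → .{{NonZero n}} → div n n ≡ 1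
div-self (suc n) = n/n≡1 (suc n)

B-one : ∀ m → 1 ≤ m → B m 1 ≡ 1
B-one m@(suc n) _ = div-self (γ* m n) {{γ*-nonZero m n (n<1+n n)}}

bracket-one : ∀ m x → 1 ≤ m → bracket m 1 x ≡ x
bracket-one m x 1≤m rewrite B-one m 1≤m = n/1≡n x

π-one : ∀ m x → 1 ≤ m → π m 1 x ≡ x
π-one m x 1≤m = begin
  bracket m 1 x * B m 1 + 0  ≡⟨ +-identityʳ _ ⟩
  bracket m 1 x * B m 1      ≡⟨ cong (bracket m 1 x *_) (B-one m 1≤m) ⟩
  bracket m 1 x * 1          ≡⟨ *-identityʳ _ ⟩
  bracket m 1 x              ≡⟨ bracket-one m x 1≤m ⟩
  x                          ∎
  where open ≡-Reasoning

π-cong-bracket : ∀ m i {x x'} → bracket m i x' ≡ bracket m i x → π m i x' ≡ π m i x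
π-cong-bracket m i eq = cong (λ b → b * B m i + offsetSum m i / 2) eq

lemma5p1 : (m : ℕ) → 3 ≤ m → (i j : ℕ) → 1 ≤ i → i ≤ m → 1 ≤ j → j ≤ m →
    (x x' : ℕ) (y : Fin 3) → InX m j x y → InX m i x' y →
    bracket m i x' ≡ bracket m i x → x' ≡ π m i x
lemma5p1 m 3≤m 1 _ _ _ _ _ x x' _ _ _ eq = begin
  x'              ≡⟨ sym (bracket-one m x' 1≤m) ⟩
  bracket m 1 x'  ≡⟨ eq ⟩
  bracket m 1 x   ≡⟨ bracket-one m x 1≤m ⟩
  x               ≡⟨ sym (π-one m x 1≤m) ⟩
  π m 1 x         ∎
  where
  open ≡-Reasoning
  1≤m : 1 ≤ m
  1≤m = ≤-trans (s≤s z≤n) 3≤m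
lemma5p1 m _ i@(suc (suc _)) _ _ _ _ _ _ _ _ _ x'∈𝕏ᵢ eq =
  trans (proj₂ x'∈𝕏ᵢ (s≤s (s≤s z≤n))) (π-cong-bracket m i eq)
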